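{- For every natural number $n \geq 1$, the number of Boolean functions $f : \{0,1\}^n \to \{0,1\}$ with $D^{\mathrm{comp}}(f) = n$ equals $2^{2^n - 1}$.
   Context: Order $\{0,1\}^n$ lexicographically, i.e. compare strings as binary representations of integers in $\{0,\dots,2^n-1\}$ with the first bit most significant. For $x \in \{0,1\}^n$, the comparison function $\theta_x : \{0,1\}^n \to \{0,1\}$ is defined by $\theta_x(y) = 1$ if and only if $y \geq x$. A comparison decision tree is a rooted tree in which every internal vertex has exactly two children (via outgoing edges labeled $0$ and $1$) and is labeled by a query function which is either some $\theta_x$ ($x \in \{0,1\}^n$) or the constant $0$ function, and every leaf is labeled by an output in $\{0,1\}$. On input $y$, one starts at the root, at each internal vertex evaluates its query function on $y$ and follows the edge labeled by the result, and outputs the label of the leaf reached. The tree computes $f$ if this output equals $f(y)$ for every $y$. Its depth is the maximum number of internal vertices on a root-to-leaf path. $D^{\mathrm{comp}}(f)$ is the minimum depth of a comparison decision tree computing $f$. -}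

module Defs where

open import Data.Bool using (Bool; true; false; if_then_else_)
open import Data.Nat using (ℕ; zero; suc; _+_; _*_; _^_; _≤_; _≤ᵇ_; _⊔_)
open import Data.Vec using (Vec; []; _∷_)
open import Data.Product using (Σ; _×_; ∃)
open import Relation.Binary.PropositionalEquality using (_≡_)

toNat : ∀ {n} → Vec Bool n → ℕ
toNat {zero} [] = 0
toNat {suc n} (b ∷ bs) = (if b then 2 ^ n else 0) + toNat bs

-- θ_x(y) = 1 iff y ≥ x in the lexicographic (= numeric) order.
θ : ∀ {n} → Vec Bool n → Vec Bool n → Bool
θ x y = toNat x ≤ᵇ toNat y

data Query (n : ℕ) : Set where
  cmp   : Vec Bool n → Query n
  const0 : Query n

evalQ : ∀ {n} → Query n → Vec Bool n → Bool
evalQ (cmp x) y = θ x y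
evalQ const0 y = false

data CTree (n : ℕ) : Set where
  leaf : Bool → CTree n
  node : Query n → CTree n → CTree n → CTree n

run : ∀ {n} → CTree n → Vec Bool n → Bool
run (leaf b) y = b
run (node q t₀ t₁) y = if evalQ q y then run t₁ y else run t₀ y

depth : ∀ {n} → CTree n → ℕ
depth (leaf _) = 0
depth (node _ t₀ t₁) = suc (depth t₀ ⊔ depth t₁)

Computes : ∀ {n} → CTree n → (Vec Bool n → Bool) → Set
Computes t f = ∀ y → run t y ≡ f y

DcompIs : ∀ {n} → (Vec Bool n → Bool) → ℕ → Set
DcompIs {n} f d =
  (Σ (CTree n) λ t → Computes t f × depth t ≡ d)
  × (∀ (t : CTree n) → Computes t f → d ≤ depth t)

_≗f_ : ∀ {n} → (Vec Bool n → Bool) → (Vec Bool n → Bool) → Set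
f ≗f g = ∀ y → f y ≡ g y

{-# OPTIONS --safe #-}

-- Read f : {0,1}ⁿ → {0,1} as the sequence of its values in lexicographic order
-- and let s(f) be the number of positions where this sequence switches value.
-- Every query of a comparison tree cuts the sequence into an initial and a final
-- segment, so by induction a tree of depth d realises at most 2^d − 1 switches:
-- at most 2^(d−1) − 1 from each subtree and one at the cut.  Conversely, cutting
-- where the running switch count first reaches 2^(d−1) builds a tree of depth d
-- whenever s(f) < 2^d.  Hence D^comp(f) = n exactly when s(f) ≥ 2^(n−1).
-- XOR-ing f with the alternating pattern 1010… turns switches into non-switches
-- and back, so s(f) + s(f ⊕ 1010…) = 2ⁿ − 1 and exactly one function of each
-- such pair has depth n.  The pairs are indexed by the truth tables vanishing
-- at 0ⁿ, of which there are 2^(2ⁿ − 1).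
module Submission where

open import Defs
open import Data.Bool using (Bool; true; false; not; _xor_; if_then_else_)
open import Data.Bool.Properties using (xor-assoc; xor-same; xor-identityʳ)
open import Data.Fin using (Fin; zero; suc; toℕ; fromℕ<)
open import Data.Fin.Properties using (toℕ-fromℕ<; toℕ-injective; toℕ<n)
open import Data.List using (List; []; _∷_; [_]; map; length; cartesianProductWith)
open import Data.List.Membership.Propositional using (_∈_)
open import Data.List.Membership.Propositional.Properties using (∈-cartesianProductWith⁺)
open import Data.List.Properties using (length-map; length-++)
open import Data.List.Relation.Unary.All as All using (All)
open import Data.List.Relation.Unary.All.Properties as All using ()
open import Data.List.Relation.Unary.AllPairs as AllPairs using (AllPairs; []; _∷_)
open import Data.List.Relation.Unary.AllPairs.Properties as AllPairs using ()
open import Data.List.Relation.Unary.Any as Any using (Any; here; there)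
open import Data.List.Relation.Unary.Any.Properties as Any using ()
open import Data.List.Relation.Unary.Unique.Propositional using (Unique)
open import Data.List.Relation.Unary.Unique.Propositional.Properties using (cartesianProductWith⁺)
open import Data.Nat using (ℕ; zero; suc; _+_; _*_; _∸_; _^_; _≤_; _<_; _≥_; _≤ᵇ_; _⊔_; NonZero;
  z≤n; s≤s; z<s; _≤?_; _<?_)
open import Data.Nat.Properties
open import Algebra.Properties.CommutativeSemigroup +-commutativeSemigroup using (interchange; xy∙z≈xz∙y)
open import Data.Product using (Σ; ∃; _×_; _,_; proj₁; proj₂)
open import Data.Sum using (inj₁; inj₂)
open import Data.Vec using (Vec; []; _∷_; lookup; tabulate)
open import Data.Vec.Properties using (∷-injective; lookup∘tabulate; tabulate∘lookup; tabulate-cong)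
open import Function.Bundles using (_⇔_; mk⇔; Equivalence)
open import Relation.Binary.PropositionalEquality
  using (_≡_; refl; sym; trans; cong; cong₂; subst; module ≡-Reasoning)
open import Relation.Nullary using (¬_; Dec; yes; no; contradiction)
open import Relation.Nullary.Reflects using (ofʸ; ofⁿ)

2^suc : ∀ n → 2 ^ suc n ≡ 2 ^ n + 2 ^ n
2^suc n = cong (2 ^ n +_) (+-identityʳ (2 ^ n))

^-cancelˡ-< : ∀ m .{{_ : NonZero m}} {a b} → m ^ a < m ^ b → a < b
^-cancelˡ-< m ma<mb = ≰⇒> (λ b≤a → <⇒≱ ma<mb (^-monoʳ-≤ m b≤a))

≤⇒≤ᵇ≡true : ∀ {m n} → m ≤ n → (m ≤ᵇ n) ≡ true
≤⇒≤ᵇ≡true {m} {n} m≤n with m ≤ᵇ n | ≤ᵇ-reflects-≤ m n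
... | true  | _       = refl
... | false | ofⁿ m≰n = contradiction m≤n m≰n

>⇒≤ᵇ≡false : ∀ {m n} → n < m → (m ≤ᵇ n) ≡ false
>⇒≤ᵇ≡false {m} {n} n<m with m ≤ᵇ n | ≤ᵇ-reflects-≤ m n
... | true  | ofʸ m≤n = contradiction m≤n (<⇒≱ n<m)
... | false | _       = refl

suc[2^n∸1]≡2^n : ∀ n → suc (2 ^ n ∸ 1) ≡ 2 ^ n
suc[2^n∸1]≡2^n n = m+[n∸m]≡n (m^n>0 2 n)

≤2^n∸1⇒<2^n : ∀ n {i} → i ≤ 2 ^ n ∸ 1 → i < 2 ^ n
≤2^n∸1⇒<2^n n i≤ = subst (_ <_) (suc[2^n∸1]≡2^n n) (s≤s i≤)

≥-half⇒<-half : ∀ {h x y} → suc (x + y) ≡ h + h → h ≤ x → y < h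
≥-half⇒<-half {h} {x} {y} suc[x+y]≡h+h h≤x = +-cancelˡ-< h y h (begin-strict
  h + y       ≤⟨ +-monoˡ-≤ y h≤x ⟩
  x + y       <⟨ n<1+n (x + y) ⟩
  suc (x + y) ≡⟨ suc[x+y]≡h+h ⟩
  h + h       ∎)
  where open ≤-Reasoning

<-half⇒≥-half : ∀ {h x y} → suc (x + y) ≡ h + h → x < h → h ≤ y
<-half⇒≥-half {h} {x} {y} suc[x+y]≡h+h x<h = ≮⇒≥ λ y<h → 1+n≰n (begin
  suc (suc (x + y)) ≡⟨ cong suc (+-suc x y) ⟨
  suc x + suc y     ≤⟨ +-mono-≤ x<h y<h ⟩
  h + h             ≡⟨ suc[x+y]≡h+h ⟨
  suc (x + y)       ∎)
  where open ≤-Reasoning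

crossing : ∀ (g : ℕ → ℕ) {h} m → g 0 < h → h ≤ g m → ∃ λ k → k < m × g k < h × h ≤ g (suc k)
crossing g zero    g0<h h≤g0 = contradiction h≤g0 (<⇒≱ g0<h)
crossing g {h} (suc m) g0<h h≤g[1+m] with h ≤? g m
... | yes h≤gm = let k , k<m , rest = crossing g m g0<h h≤gm in k , m<n⇒m<1+n k<m , rest
... | no  h≰gm = m , ≤-refl , ≰⇒> h≰gm , h≤g[1+m]

fromNat : ∀ n → ℕ → Vec Bool n
fromNat zero    _ = []
fromNat (suc n) i with 2 ^ n ≤? i
... | yes _ = true ∷ fromNat n (i ∸ 2 ^ n)
... | no  _ = false ∷ fromNat n i

toNat<2^n : ∀ {n} (v : Vec Bool n) → toNat v < 2 ^ n
toNat<2^n []                = z<s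
toNat<2^n {suc n} (false ∷ v) = <-≤-trans (toNat<2^n v) (m≤m+n (2 ^ n) _)
toNat<2^n {suc n} (true ∷ v)  =
  subst (2 ^ n + toNat v <_) (sym (2^suc n)) (+-monoʳ-< (2 ^ n) (toNat<2^n v))

fromNat-toNat : ∀ {n} (v : Vec Bool n) → fromNat n (toNat v) ≡ v
fromNat-toNat [] = refl
fromNat-toNat {suc n} (b ∷ v) with 2 ^ n ≤? toNat (b ∷ v)
fromNat-toNat {suc n} (true ∷ v)  | yes _ =
  cong (true ∷_) (trans (cong (fromNat n) (m+n∸m≡n (2 ^ n) (toNat v))) (fromNat-toNat v))
fromNat-toNat {suc n} (false ∷ v) | yes 2^n≤v = contradiction 2^n≤v (<⇒≱ (toNat<2^n v))
fromNat-toNat {suc n} (true ∷ v)  | no 2^n≰ = contradiction (m≤m+n (2 ^ n) (toNat v)) 2^n≰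
fromNat-toNat {suc n} (false ∷ v) | no _ = cong (false ∷_) (fromNat-toNat v)

toNat-fromNat : ∀ n {i} → i < 2 ^ n → toNat (fromNat n i) ≡ i
toNat-fromNat zero    {zero}  _         = refl
toNat-fromNat zero    {suc _} (s≤s ())
toNat-fromNat (suc n) {i} i<2^[1+n] with 2 ^ n ≤? i
... | yes 2^n≤i = trans (cong (2 ^ n +_) (toNat-fromNat n rest<2^n)) (m+[n∸m]≡n 2^n≤i)
  where
  rest<2^n : i ∸ 2 ^ n < 2 ^ n
  rest<2^n = +-cancelˡ-< (2 ^ n) _ _ (begin-strict
    2 ^ n + (i ∸ 2 ^ n) ≡⟨ m+[n∸m]≡n 2^n≤i ⟩
    i                   <⟨ i<2^[1+n] ⟩
    2 ^ suc n           ≡⟨ 2^suc n ⟩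
    2 ^ n + 2 ^ n       ∎)
    where open ≤-Reasoning
... | no 2^n≰i = toNat-fromNat n (≰⇒> 2^n≰i)

allVecs : ∀ m → List (Vec Bool m)
allVecs zero    = [ [] ]
allVecs (suc m) = cartesianProductWith _∷_ (false ∷ true ∷ []) (allVecs m)

allVecs-unique : ∀ m → Unique (allVecs m)
allVecs-unique zero    = All.[] ∷ []
allVecs-unique (suc m) =
  cartesianProductWith⁺ _∷_ ∷-injective (((λ ()) All.∷ All.[]) ∷ All.[] ∷ []) (allVecs-unique m)

∈-allVecs : ∀ {m} (v : Vec Bool m) → v ∈ allVecs m
∈-allVecs []      = here refl
∈-allVecs (b ∷ v) = ∈-cartesianProductWith⁺ _∷_ (b∈ b) (∈-allVecs v)
  where
  b∈ : ∀ b → b ∈ false ∷ true ∷ []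
  b∈ false = here refl
  b∈ true  = there (here refl)

length-cartesianProductWith : ∀ {A B C : Set} (f : A → B → C) xs ys →
  length (cartesianProductWith f xs ys) ≡ length xs * length ys
length-cartesianProductWith f []       ys = refl
length-cartesianProductWith f (x ∷ xs) ys =
  trans (length-++ (map (f x) ys))
        (cong₂ _+_ (length-map (f x) ys) (length-cartesianProductWith f xs ys))

length-allVecs : ∀ m → length (allVecs m) ≡ 2 ^ m
length-allVecs zero    = refl
length-allVecs (suc m) =
  trans (length-cartesianProductWith _∷_ (false ∷ true ∷ []) (allVecs m)) (cong (2 *_) (length-allVecs m))

module _ {A B : Set} (_≈_ : B → B → Set) (P : B → Set) (enc : A → B) (dec : B → A) where

  enumeration-via-retraction : ∀ xs → Unique xs → (∀ a → a ∈ xs) →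
    (∀ {b b′} → b ≈ b′ → dec b ≡ dec b′) → (∀ a → dec (enc a) ≡ a) →
    (∀ a → P (enc a)) → (∀ b → P b → b ≈ enc (dec b)) →
    AllPairs (λ b b′ → ¬ b ≈ b′) (map enc xs) × All P (map enc xs) ×
    (∀ b → P b → Any (b ≈_) (map enc xs))
  enumeration-via-retraction xs unique ∈xs dec-cong dec-enc P-enc P⇒≈enc =
    AllPairs.map⁺ (AllPairs.map distinct unique) ,
    All.map⁺ (All.universal P-enc xs) ,
    λ b Pb → Any.map⁺ (Any.map (λ { refl → P⇒≈enc b Pb }) (∈xs (dec b)))
    where
    distinct : ∀ {a a′} → ¬ a ≡ a′ → ¬ enc a ≈ enc a′
    distinct {a} {a′} a≢a′ ea≈ea′ = a≢a′ (begin
      a             ≡⟨ dec-enc a ⟨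
      dec (enc a)   ≡⟨ dec-cong ea≈ea′ ⟩
      dec (enc a′)  ≡⟨ dec-enc a′ ⟩
      a′            ∎)
      where open ≡-Reasoning

-- Switches of a Boolean sequence

switch : Bool → Bool → ℕ
switch false false = 0
switch true  true  = 0
switch false true  = 1
switch true  false = 1

switch≤1 : ∀ x y → switch x y ≤ 1
switch≤1 false false = z≤n
switch≤1 true  true  = z≤n
switch≤1 false true  = ≤-refl
switch≤1 true  false = ≤-refl

switch-refl : ∀ x → switch x x ≡ 0
switch-refl false = refl
switch-refl true  = refl

switch≡0⇒≡ : ∀ {x y} → switch x y ≡ 0 → x ≡ y
switch≡0⇒≡ {false} {false} _ = refl
switch≡0⇒≡ {true}  {true}  _ = refl

switch+switch-xor-alternating : ∀ x y p → switch x y + switch (x xor p) (y xor not p) ≡ 1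
switch+switch-xor-alternating false false false = refl
switch+switch-xor-alternating false false true  = refl
switch+switch-xor-alternating false true  false = refl
switch+switch-xor-alternating false true  true  = refl
switch+switch-xor-alternating true  false false = refl
switch+switch-xor-alternating true  false true  = refl
switch+switch-xor-alternating true  true  false = refl
switch+switch-xor-alternating true  true  true  = refl

switches : (ℕ → Bool) → ℕ → ℕ → ℕ
switches F a zero    = 0
switches F a (suc m) = switches F a m + switch (F (a + m)) (F (suc (a + m)))

AgreeOn : ℕ → ℕ → (ℕ → Bool) → (ℕ → Bool) → Set
AgreeOn a m F G = ∀ j → j ≤ m → F (a + j) ≡ G (a + j)

switches≤ : ∀ F a m → switches F a m ≤ m
switches≤ F a zero    = z≤n
switches≤ F a (suc m) =
  subst (switches F a (suc m) ≤_) (+-comm m 1) (+-mono-≤ (switches≤ F a m) (switch≤1 _ _))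

switches-+ : ∀ F a k m → switches F a (k + m) ≡ switches F a k + switches F (a + k) m
switches-+ F a k zero    rewrite +-identityʳ k = sym (+-identityʳ _)
switches-+ F a k (suc m) rewrite +-suc k m | switches-+ F a k m | +-assoc a k m =
  +-assoc (switches F a k) (switches F (a + k) m) _

switches-congᵢ : ∀ {F G a m} → AgreeOn a m F G → switches F a m ≡ switches G a m
switches-congᵢ {m = zero}        _     = refl
switches-congᵢ {F} {G} {a} {suc m} F≐G =
  cong₂ _+_ (switches-congᵢ (λ j j≤m → F≐G j (m≤n⇒m≤1+n j≤m)))
            (cong₂ switch (F≐G m (n≤1+n m)) last)
  where
  last : F (suc (a + m)) ≡ G (suc (a + m))
  last = subst (λ i → F i ≡ G i) (+-suc a m) (F≐G (suc m) ≤-refl)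

switches-const : ∀ b a m → switches (λ _ → b) a m ≡ 0
switches-const b a zero    = refl
switches-const b a (suc m) rewrite switches-const b a m = switch-refl b

switches≡0⇒AgreeOn-const : ∀ {F a} m → switches F a m ≡ 0 → AgreeOn a m (λ _ → F a) F
switches≡0⇒AgreeOn-const {F} {a} zero    _ zero z≤n = cong F (sym (+-identityʳ a))
switches≡0⇒AgreeOn-const {F} {a} (suc m) s≡0 j j≤1+m with m≤n⇒m<n∨m≡n j≤1+m
... | inj₁ j<1+m = switches≡0⇒AgreeOn-const m (m+n≡0⇒m≡0 _ s≡0) j (≤-pred j<1+m)
... | inj₂ refl  = begin
  F a               ≡⟨ switches≡0⇒AgreeOn-const m (m+n≡0⇒m≡0 _ s≡0) m ≤-refl ⟩
  F (a + m)         ≡⟨ switch≡0⇒≡ (m+n≡0⇒n≡0 (switches F a m) s≡0) ⟩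
  F (suc (a + m))   ≡⟨ cong F (sym (+-suc a m)) ⟩
  F (a + suc m)     ∎
  where open ≡-Reasoning

even : ℕ → Bool
even zero    = true
even (suc i) = not (even i)

switches+switches-xor-even : ∀ F a m → switches F a m + switches (λ i → F i xor even i) a m ≡ m
switches+switches-xor-even F a zero    = refl
switches+switches-xor-even F a (suc m) = begin
  (s + w) + (s′ + w′) ≡⟨ interchange s w s′ w′ ⟩
  (s + s′) + (w + w′) ≡⟨ cong₂ _+_ (switches+switches-xor-even F a m)
                          (switch+switch-xor-alternating (F i) (F (suc i)) (even i)) ⟩
  m + 1               ≡⟨ +-comm m 1 ⟩
  suc m               ∎
  where
  open ≡-Reasoning
  i = a + m
  s = switches F a m
  s′ = switches (λ i → F i xor even i) a m
  w = switch (F i) (F (suc i))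
  w′ = switch (F i xor even i) (F (suc i) xor even (suc i))

-- Threshold trees on ℕ

splice : ℕ → (ℕ → Bool) → (ℕ → Bool) → ℕ → Bool
splice c F₀ F₁ i = if c ≤ᵇ i then F₁ i else F₀ i

splice-< : ∀ {c} F₀ F₁ {i} → i < c → splice c F₀ F₁ i ≡ F₀ i
splice-< _ _ i<c rewrite >⇒≤ᵇ≡false i<c = refl

splice-≥ : ∀ {c} F₀ F₁ {i} → c ≤ i → splice c F₀ F₁ i ≡ F₁ i
splice-≥ _ _ c≤i rewrite ≤⇒≤ᵇ≡true c≤i = refl

-- The one switch a splice can add is the one at the cut c.
switches-splice≤ : ∀ c F₀ F₁ a m →
  switches (splice c F₀ F₁) a m ≤ suc (switches F₀ a m + switches F₁ a m)
switches-splice≤ c F₀ F₁ a zero    = z≤n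
switches-splice≤ c F₀ F₁ a (suc m) = step (c ≤? i) (c ≤? suc i)
  where
  open ≤-Reasoning
  G = splice c F₀ F₁
  i = a + m
  s = switches G a m
  s₀ = switches F₀ a m
  s₁ = switches F₁ a m
  w₀ = switch (F₀ i) (F₀ (suc i))
  w₁ = switch (F₁ i) (F₁ (suc i))
  step : Dec (c ≤ i) → Dec (c ≤ suc i) → s + switch (G i) (G (suc i)) ≤ suc ((s₀ + w₀) + (s₁ + w₁))
  step (yes c≤i) _ = begin
    s + switch (G i) (G (suc i)) ≡⟨ cong (s +_) (cong₂ switch (splice-≥ F₀ F₁ c≤i)
                                                              (splice-≥ F₀ F₁ (m≤n⇒m≤1+n c≤i))) ⟩
    s + w₁                       ≤⟨ +-monoˡ-≤ w₁ (switches-splice≤ c F₀ F₁ a m) ⟩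
    suc (s₀ + s₁) + w₁           ≡⟨ cong suc (+-assoc s₀ s₁ w₁) ⟩
    suc (s₀ + (s₁ + w₁))         ≤⟨ s≤s (+-monoˡ-≤ (s₁ + w₁) (m≤m+n s₀ w₀)) ⟩
    suc ((s₀ + w₀) + (s₁ + w₁))  ∎
  step (no c≰i) (yes _) = begin
    s + switch (G i) (G (suc i))  ≡⟨ cong (_+ switch (G i) (G (suc i))) (switches-congᵢ G≐F₀) ⟩
    s₀ + switch (G i) (G (suc i)) ≤⟨ +-monoʳ-≤ s₀ (switch≤1 _ _) ⟩
    s₀ + 1                        ≡⟨ +-comm s₀ 1 ⟩
    suc s₀                        ≤⟨ s≤s (≤-trans (m≤m+n s₀ w₀) (m≤m+n _ _)) ⟩
    suc ((s₀ + w₀) + (s₁ + w₁))   ∎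
    where
    G≐F₀ : AgreeOn a m G F₀
    G≐F₀ j j≤m = splice-< F₀ F₁ (≤-<-trans (+-monoʳ-≤ a j≤m) (≰⇒> c≰i))
  step (no c≰i) (no c≰1+i) = begin
    s + switch (G i) (G (suc i)) ≡⟨ cong (s +_) (cong₂ switch (splice-< F₀ F₁ (≰⇒> c≰i))
                                                              (splice-< F₀ F₁ (≰⇒> c≰1+i))) ⟩
    s + w₀                       ≤⟨ +-monoˡ-≤ w₀ (switches-splice≤ c F₀ F₁ a m) ⟩
    suc (s₀ + s₁) + w₀           ≡⟨ cong suc (xy∙z≈xz∙y s₀ s₁ w₀) ⟩
    suc ((s₀ + w₀) + s₁)         ≤⟨ s≤s (+-monoʳ-≤ (s₀ + w₀) (m≤m+n s₁ w₁)) ⟩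
    suc ((s₀ + w₀) + (s₁ + w₁))  ∎

data ThresholdTree : Set where
  leaf : Bool → ThresholdTree
  node : ℕ → ThresholdTree → ThresholdTree → ThresholdTree

evalᵀ : ThresholdTree → ℕ → Bool
evalᵀ (leaf b)       _ = b
evalᵀ (node c t₀ t₁)   = splice c (evalᵀ t₀) (evalᵀ t₁)

depthᵀ : ThresholdTree → ℕ
depthᵀ (leaf _)       = 0
depthᵀ (node _ t₀ t₁) = suc (depthᵀ t₀ ⊔ depthᵀ t₁)

switches-evalᵀ< : ∀ t a m → switches (evalᵀ t) a m < 2 ^ depthᵀ t
switches-evalᵀ< (leaf b)       a m = subst (_< 1) (sym (switches-const b a m)) z<s
switches-evalᵀ< (node c t₀ t₁) a m = begin-strict
  switches (evalᵀ (node c t₀ t₁)) a m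
    ≤⟨ switches-splice≤ c (evalᵀ t₀) (evalᵀ t₁) a m ⟩
  suc (s₀ + s₁)
    <⟨ +-mono-≤-< (switches-evalᵀ< t₀ a m) (switches-evalᵀ< t₁ a m) ⟩
  2 ^ d₀ + 2 ^ d₁
    ≤⟨ +-mono-≤ (^-monoʳ-≤ 2 (m≤m⊔n d₀ d₁)) (^-monoʳ-≤ 2 (m≤n⊔m d₀ d₁)) ⟩
  2 ^ (d₀ ⊔ d₁) + 2 ^ (d₀ ⊔ d₁)
    ≡⟨ 2^suc (d₀ ⊔ d₁) ⟨
  2 ^ suc (d₀ ⊔ d₁)
    ∎
  where
  open ≤-Reasoning
  s₀ = switches (evalᵀ t₀) a m
  s₁ = switches (evalᵀ t₁) a m
  d₀ = depthᵀ t₀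
  d₁ = depthᵀ t₁

-- Cut [a, a + m] right after the first point where the switch count reaches 2^d.
switches<⇒ThresholdTree : ∀ F d a m → switches F a m < 2 ^ d →
  Σ ThresholdTree λ t → depthᵀ t ≤ d × AgreeOn a m (evalᵀ t) F
switches<⇒ThresholdTree F zero a m s<1 =
  leaf (F a) , z≤n , switches≡0⇒AgreeOn-const m (n<1⇒n≡0 s<1)
switches<⇒ThresholdTree F (suc d) a m s<2^[1+d] with switches F a m <? 2 ^ d
... | yes s<2^d =
  let t , t≤d , t≐F = switches<⇒ThresholdTree F d a m s<2^d in t , m≤n⇒m≤1+n t≤d , t≐F
... | no s≮2^d with crossing (switches F a) m (m^n>0 2 d) (≮⇒≥ s≮2^d)
... | k , k<m , left<2^d , 2^d≤ with m≤n⇒∃[o]m+o≡n k<m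
... | m′ , refl = node c t₀ t₁ , s≤s (⊔-lub t₀≤d t₁≤d) , t≐F
  where
  c = a + suc k
  right<2^d : switches F c m′ < 2 ^ d
  right<2^d = +-cancelˡ-< (2 ^ d) _ _ (begin-strict
    2 ^ d + switches F c m′                ≤⟨ +-monoˡ-≤ _ 2^d≤ ⟩
    switches F a (suc k) + switches F c m′ ≡⟨ switches-+ F a (suc k) m′ ⟨
    switches F a (suc k + m′)              <⟨ s<2^[1+d] ⟩
    2 ^ suc d                              ≡⟨ 2^suc d ⟩
    2 ^ d + 2 ^ d                          ∎)
    where open ≤-Reasoning
  left = switches<⇒ThresholdTree F d a k left<2^d
  right = switches<⇒ThresholdTree F d c m′ right<2^d
  t₀ = proj₁ left
  t₁ = proj₁ right
  t₀≤d = proj₁ (proj₂ left)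
  t₁≤d = proj₁ (proj₂ right)
  t≐F : AgreeOn a (suc k + m′) (evalᵀ (node c t₀ t₁)) F
  t≐F j j≤ with j ≤? k
  ... | yes j≤k =
    trans (splice-< (evalᵀ t₀) (evalᵀ t₁) (+-monoʳ-< a (s≤s j≤k))) (proj₂ (proj₂ left) j j≤k)
  ... | no j≰k with m≤n⇒∃[o]m+o≡n (≰⇒> j≰k)
  ...   | j′ , refl = begin
    evalᵀ (node c t₀ t₁) (a + (suc k + j′)) ≡⟨ cong (evalᵀ (node c t₀ t₁)) (+-assoc a (suc k) j′) ⟨
    evalᵀ (node c t₀ t₁) (c + j′)           ≡⟨ splice-≥ (evalᵀ t₀) (evalᵀ t₁) (m≤m+n c j′) ⟩
    evalᵀ t₁ (c + j′)                       ≡⟨ proj₂ (proj₂ right) j′ (+-cancelˡ-≤ (suc k) _ _ j≤) ⟩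
    F (c + j′)                              ≡⟨ cong F (+-assoc a (suc k) j′) ⟩
    F (a + (suc k + j′))                    ∎
    where open ≡-Reasoning

-- Comparison trees as threshold trees

module _ {n : ℕ} where

  threshold : Query n → ℕ
  threshold (cmp x) = toNat x
  threshold const0  = 2 ^ n

  query : ℕ → Query n
  query c with c <? 2 ^ n
  ... | yes _ = cmp (fromNat n c)
  ... | no  _ = const0

  evalQ-threshold : ∀ q {i} → i < 2 ^ n → evalQ q (fromNat n i) ≡ (threshold q ≤ᵇ i)
  evalQ-threshold (cmp x) i<2^n = cong (toNat x ≤ᵇ_) (toNat-fromNat n i<2^n)
  evalQ-threshold const0  i<2^n = sym (>⇒≤ᵇ≡false i<2^n)

  evalQ-query : ∀ c {i} → i < 2 ^ n → evalQ (query c) (fromNat n i) ≡ (c ≤ᵇ i)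
  evalQ-query c i<2^n with c <? 2 ^ n
  ... | yes c<2^n = cong₂ _≤ᵇ_ (toNat-fromNat n c<2^n) (toNat-fromNat n i<2^n)
  ... | no  c≮2^n = sym (>⇒≤ᵇ≡false (<-≤-trans i<2^n (≮⇒≥ c≮2^n)))

  toThresholdTree : CTree n → ThresholdTree
  toThresholdTree (leaf b)       = leaf b
  toThresholdTree (node q t₀ t₁) = node (threshold q) (toThresholdTree t₀) (toThresholdTree t₁)

  fromThresholdTree : ThresholdTree → CTree n
  fromThresholdTree (leaf b)       = leaf b
  fromThresholdTree (node c t₀ t₁) = node (query c) (fromThresholdTree t₀) (fromThresholdTree t₁)

  depthᵀ-toThresholdTree : ∀ t → depthᵀ (toThresholdTree t) ≡ depth t
  depthᵀ-toThresholdTree (leaf _)       = refl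
  depthᵀ-toThresholdTree (node _ t₀ t₁) =
    cong suc (cong₂ _⊔_ (depthᵀ-toThresholdTree t₀) (depthᵀ-toThresholdTree t₁))

  depth-fromThresholdTree : ∀ t → depth (fromThresholdTree t) ≡ depthᵀ t
  depth-fromThresholdTree (leaf _)       = refl
  depth-fromThresholdTree (node _ t₀ t₁) =
    cong suc (cong₂ _⊔_ (depth-fromThresholdTree t₀) (depth-fromThresholdTree t₁))

  run-toThresholdTree : ∀ t {i} → i < 2 ^ n → run t (fromNat n i) ≡ evalᵀ (toThresholdTree t) i
  run-toThresholdTree (leaf _)       _ = refl
  run-toThresholdTree (node q t₀ t₁) i<2^n
    rewrite evalQ-threshold q i<2^n
          | run-toThresholdTree t₀ i<2^n
          | run-toThresholdTree t₁ i<2^n = refl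

  run-fromThresholdTree : ∀ t {i} → i < 2 ^ n → run (fromThresholdTree t) (fromNat n i) ≡ evalᵀ t i
  run-fromThresholdTree (leaf _)       _ = refl
  run-fromThresholdTree (node c t₀ t₁) i<2^n
    rewrite evalQ-query c i<2^n
          | run-fromThresholdTree t₀ i<2^n
          | run-fromThresholdTree t₁ i<2^n = refl

module _ {n : ℕ} where

  valuesOf : (Vec Bool n → Bool) → ℕ → Bool
  valuesOf f i = f (fromNat n i)

  switchCount : (Vec Bool n → Bool) → ℕ
  switchCount f = switches (valuesOf f) 0 (2 ^ n ∸ 1)

  switchCount-cong : ∀ {f g} → f ≗f g → switchCount f ≡ switchCount g
  switchCount-cong {f} {g} f≗g =
    switches-congᵢ {valuesOf f} {valuesOf g} {m = 2 ^ n ∸ 1} (λ j _ → f≗g (fromNat n j))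

  switchCount<2^n : ∀ f → switchCount f < 2 ^ n
  switchCount<2^n f = ≤2^n∸1⇒<2^n n (switches≤ (valuesOf f) 0 (2 ^ n ∸ 1))

  switchCount<2^depth : ∀ t f → Computes t f → switchCount f < 2 ^ depth t
  switchCount<2^depth t f t⊢f = begin-strict
    switchCount f                     ≡⟨ switches-congᵢ {valuesOf f} {tᵀ} {m = 2 ^ n ∸ 1} f≐t ⟩
    switches tᵀ 0 (2 ^ n ∸ 1)         <⟨ switches-evalᵀ< (toThresholdTree t) 0 (2 ^ n ∸ 1) ⟩
    2 ^ depthᵀ (toThresholdTree t)    ≡⟨ cong (2 ^_) (depthᵀ-toThresholdTree t) ⟩
    2 ^ depth t                       ∎
    where
    open ≤-Reasoning
    tᵀ = evalᵀ (toThresholdTree t)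
    f≐t : AgreeOn 0 (2 ^ n ∸ 1) (valuesOf f) tᵀ
    f≐t j j≤ = trans (sym (t⊢f (fromNat n j))) (run-toThresholdTree t (≤2^n∸1⇒<2^n n j≤))

  switchCount<⇒CTree : ∀ f d → switchCount f < 2 ^ d → Σ (CTree n) λ t → depth t ≤ d × Computes t f
  switchCount<⇒CTree f d s<2^d =
    fromThresholdTree t , subst (_≤ d) (sym (depth-fromThresholdTree t)) t≤d , t⊢f
    where
    tree = switches<⇒ThresholdTree (valuesOf f) d 0 (2 ^ n ∸ 1) s<2^d
    t = proj₁ tree
    t≤d = proj₁ (proj₂ tree)
    toNat≤ : ∀ y → toNat y ≤ 2 ^ n ∸ 1
    toNat≤ y = ≤-pred (subst (suc (toNat y) ≤_) (sym (suc[2^n∸1]≡2^n n)) (toNat<2^n y))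
    t⊢f : Computes (fromThresholdTree t) f
    t⊢f y = begin
      run (fromThresholdTree t) y                    ≡⟨ cong (run (fromThresholdTree t)) (fromNat-toNat y) ⟨
      run (fromThresholdTree t) (fromNat n (toNat y)) ≡⟨ run-fromThresholdTree t (toNat<2^n y) ⟩
      evalᵀ t (toNat y)                               ≡⟨ proj₂ (proj₂ tree) (toNat y) (toNat≤ y) ⟩
      f (fromNat n (toNat y))                         ≡⟨ cong f (fromNat-toNat y) ⟩
      f y                                             ∎
      where open ≡-Reasoning

  DcompIs-suc⇔ : ∀ f k → DcompIs f (suc k) ⇔ (2 ^ k ≤ switchCount f × switchCount f < 2 ^ suc k)
  DcompIs-suc⇔ f k = mk⇔ to from
    where
    to : DcompIs f (suc k) → 2 ^ k ≤ switchCount f × switchCount f < 2 ^ suc k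
    to ((t , t⊢f , t≡1+k) , minimal) =
      ≮⇒≥ no-shallow-tree , subst (λ d → switchCount f < 2 ^ d) t≡1+k (switchCount<2^depth t f t⊢f)
      where
      no-shallow-tree : ¬ switchCount f < 2 ^ k
      no-shallow-tree s<2^k =
        let t′ , t′≤k , t′⊢f = switchCount<⇒CTree f k s<2^k in 1+n≰n (≤-trans (minimal t′ t′⊢f) t′≤k)
    from : 2 ^ k ≤ switchCount f × switchCount f < 2 ^ suc k → DcompIs f (suc k)
    from (2^k≤s , s<2^[1+k]) = (t , t⊢f , ≤-antisym t≤1+k (minimal t t⊢f)) , minimal
      where
      minimal : ∀ t′ → Computes t′ f → suc k ≤ depth t′
      minimal t′ t′⊢f = ^-cancelˡ-< 2 (≤-<-trans 2^k≤s (switchCount<2^depth t′ f t′⊢f))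
      tree = switchCount<⇒CTree f (suc k) s<2^[1+k]
      t = proj₁ tree
      t≤1+k = proj₁ (proj₂ tree)
      t⊢f = proj₂ (proj₂ tree)

  alternate : (Vec Bool n → Bool) → Vec Bool n → Bool
  alternate f y = f y xor even (toNat y)

  alternate-cong : ∀ {f g} → f ≗f g → alternate f ≗f alternate g
  alternate-cong f≗g y = cong (_xor even (toNat y)) (f≗g y)

  alternate-involutive : ∀ f → alternate (alternate f) ≗f f
  alternate-involutive f y = begin
    (f y xor p) xor p ≡⟨ xor-assoc (f y) p p ⟩
    f y xor (p xor p) ≡⟨ cong (f y xor_) (xor-same p) ⟩
    f y xor false     ≡⟨ xor-identityʳ (f y) ⟩
    f y               ∎
    where
    open ≡-Reasoning
    p = even (toNat y)

  switchCount+switchCount-alternate : ∀ f → switchCount f + switchCount (alternate f) ≡ 2 ^ n ∸ 1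
  switchCount+switchCount-alternate f =
    trans (cong (switchCount f +_) (switches-congᵢ {m = 2 ^ n ∸ 1} alternate≐))
          (switches+switches-xor-even (valuesOf f) 0 (2 ^ n ∸ 1))
    where
    F⊕even : ℕ → Bool
    F⊕even i = valuesOf f i xor even i
    alternate≐ : AgreeOn 0 (2 ^ n ∸ 1) (valuesOf (alternate f)) F⊕even
    alternate≐ j j≤ = cong (λ i → valuesOf f j xor even i) (toNat-fromNat n (≤2^n∸1⇒<2^n n j≤))

  origin : Vec Bool n
  origin = fromNat n 0

  toNat-origin : toNat origin ≡ 0
  toNat-origin = toNat-fromNat n (m^n>0 2 n)

  -- A truth table listed in lexicographic order, its entry at the origin omitted.
  code : (Vec Bool n → Bool) → Vec Bool (2 ^ n ∸ 1)
  code f = tabulate (λ i → f (fromNat n (suc (toℕ i))))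

  index : Vec Bool n → Fin (suc (2 ^ n ∸ 1))
  index y = fromℕ< (subst (toNat y <_) (sym (suc[2^n∸1]≡2^n n)) (toNat<2^n y))

  decode : Vec Bool (2 ^ n ∸ 1) → Vec Bool n → Bool
  decode c y = lookup (false ∷ c) (index y)

  toℕ-index-fromNat : ∀ {i} → i < 2 ^ n → toℕ (index (fromNat n i)) ≡ i
  toℕ-index-fromNat i<2^n = trans (toℕ-fromℕ< _) (toNat-fromNat n i<2^n)

  code-cong : ∀ {f g} → f ≗f g → code f ≡ code g
  code-cong f≗g = tabulate-cong (λ i → f≗g (fromNat n (suc (toℕ i))))

  decode-origin : ∀ c → decode c origin ≡ false
  decode-origin c = cong (lookup (false ∷ c)) (toℕ-injective (trans (toℕ-fromℕ< _) toNat-origin))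

  code-decode : ∀ c → code (decode c) ≡ c
  code-decode c = trans (tabulate-cong decode-suc) (tabulate∘lookup c)
    where
    decode-suc : ∀ i → decode c (fromNat n (suc (toℕ i))) ≡ lookup c i
    decode-suc i =
      cong (lookup (false ∷ c)) (toℕ-injective (toℕ-index-fromNat (≤2^n∸1⇒<2^n n (toℕ<n i))))

  decode-code : ∀ f → f origin ≡ false → decode (code f) ≗f f
  decode-code f f₀ y = lookup-code (index y) (trans (cong (fromNat n) (toℕ-fromℕ< _)) (fromNat-toNat y))
    where
    lookup-code : ∀ j → fromNat n (toℕ j) ≡ y → lookup (false ∷ code f) j ≡ f y
    lookup-code zero    origin≡y = trans (sym f₀) (cong f origin≡y)
    lookup-code (suc i) j≡y      = trans (lookup∘tabulate _ i) (cong f j≡y)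

module FullDepth (k : ℕ) where

  Fun : Set
  Fun = Vec Bool (suc k) → Bool

  suc[s+s-alternate]≡2^k+2^k : ∀ (f : Fun) → suc (switchCount f + switchCount (alternate f)) ≡ 2 ^ k + 2 ^ k
  suc[s+s-alternate]≡2^k+2^k f =
    trans (cong suc (switchCount+switchCount-alternate f)) (trans (suc[2^n∸1]≡2^n (suc k)) (2^suc k))

  representative : Fun → Fun
  representative f with 2 ^ k ≤? switchCount f
  ... | yes _ = f
  ... | no  _ = alternate f

  2^k≤switchCount-representative : ∀ (f : Fun) → 2 ^ k ≤ switchCount (representative f)
  2^k≤switchCount-representative f with 2 ^ k ≤? switchCount f
  ... | yes 2^k≤s = 2^k≤s
  ... | no  2^k≰s = <-half⇒≥-half (suc[s+s-alternate]≡2^k+2^k f) (≰⇒> 2^k≰s)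

  representative-cong : ∀ {f g : Fun} → f ≗f g → representative f ≗f representative g
  representative-cong {f} {g} f≗g with 2 ^ k ≤? switchCount f | 2 ^ k ≤? switchCount g
  ... | yes _     | yes _     = f≗g
  ... | no  _     | no  _     = alternate-cong f≗g
  ... | yes 2^k≤s | no  2^k≰s = contradiction (subst (2 ^ k ≤_) (switchCount-cong f≗g) 2^k≤s) 2^k≰s
  ... | no  2^k≰s | yes 2^k≤s = contradiction (subst (2 ^ k ≤_) (sym (switchCount-cong f≗g)) 2^k≤s) 2^k≰s

  normalize : Fun → Fun
  normalize f y = if f origin then alternate f y else f y

  normalize-cong : ∀ {f g : Fun} → f ≗f g → normalize f ≗f normalize g
  normalize-cong {f} {g} f≗g y rewrite f≗g origin | f≗g y = refl

  normalize-origin : ∀ (f : Fun) → normalize f origin ≡ false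
  normalize-origin f with f origin in f₀
  ... | false = refl
  ... | true  = cong (λ i → not (even i)) (toNat-origin {suc k})

  representative-deep : ∀ {f : Fun} → 2 ^ k ≤ switchCount f → representative f ≗f f
  representative-deep {f} 2^k≤s with 2 ^ k ≤? switchCount f
  ... | yes _     = λ _ → refl
  ... | no  2^k≰s = contradiction 2^k≤s 2^k≰s

  representative-shallow : ∀ {f : Fun} → switchCount f < 2 ^ k → representative f ≗f alternate f
  representative-shallow {f} s<2^k with 2 ^ k ≤? switchCount f
  ... | yes 2^k≤s = contradiction 2^k≤s (<⇒≱ s<2^k)
  ... | no  _     = λ _ → refl

  normalize-representative : ∀ (g : Fun) → g origin ≡ false → normalize (representative g) ≗f g
  normalize-representative g g₀ y with 2 ^ k ≤? switchCount g
  ... | yes _ rewrite g₀ = refl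
  ... | no  _ rewrite g₀ | toNat-origin {suc k} = alternate-involutive g y

  representative-normalize : ∀ (f : Fun) → 2 ^ k ≤ switchCount f → representative (normalize f) ≗f f
  representative-normalize f 2^k≤s y with f origin
  ... | false = representative-deep 2^k≤s y
  ... | true  = trans (representative-shallow (≥-half⇒<-half (suc[s+s-alternate]≡2^k+2^k f) 2^k≤s) y)
                      (alternate-involutive f y)

  representative-DcompIs : ∀ (f : Fun) → DcompIs (representative f) (suc k)
  representative-DcompIs f = Equivalence.from (DcompIs-suc⇔ (representative f) k)
    (2^k≤switchCount-representative f , switchCount<2^n (representative f))

  code-normalize-representative : ∀ c → code (normalize (representative (decode c))) ≡ c
  code-normalize-representative c =
    trans (code-cong (normalize-representative (decode c) (decode-origin {suc k} c))) (code-decode {suc k} c)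

  DcompIs⇒≗representative : ∀ (f : Fun) → DcompIs f (suc k) →
    f ≗f representative (decode (code (normalize f)))
  DcompIs⇒≗representative f D y = begin
    f y                                            ≡⟨ representative-normalize f 2^k≤s y ⟨
    representative (normalize f) y                 ≡⟨ representative-cong normalize≗ y ⟩
    representative (decode (code (normalize f))) y ∎
    where
    open ≡-Reasoning
    2^k≤s = proj₁ (Equivalence.to (DcompIs-suc⇔ f k) D)
    normalize≗ : normalize f ≗f decode (code (normalize f))
    normalize≗ z = sym (decode-code (normalize f) (normalize-origin f) z)

mainTheorem3 : (n : ℕ) → n ≥ 1 →
    Σ (List (Vec Bool n → Bool)) λ L →
    AllPairs (λ f g → ¬ (f ≗f g)) L
    × All (λ f → DcompIs f n) L
    × (∀ (f : Vec Bool n → Bool) → DcompIs f n → Any (λ g → f ≗f g) L)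
    × length L ≡ 2 ^ (2 ^ n ∸ 1)
mainTheorem3 zero ()
mainTheorem3 (suc k) _ =
  let distinct , full-depth , complete =
        enumeration-via-retraction _≗f_ (λ f → DcompIs f (suc k)) enc (λ f → code (normalize f))
          codes (allVecs-unique _) ∈-allVecs (λ f≗g → code-cong (normalize-cong f≗g))
          code-normalize-representative (λ c → representative-DcompIs (decode c))
          DcompIs⇒≗representative
  in map enc codes , distinct , full-depth , complete ,
     trans (length-map enc codes) (length-allVecs (2 ^ suc k ∸ 1))
  where
  open FullDepth k
  codes = allVecs (2 ^ suc k ∸ 1)
  enc : Vec Bool (2 ^ suc k ∸ 1) → Fun
  enc c = representative (decode c)
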